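{- For every nontrivial connected graph $G$, $\gamma_{tR2}(G)\le 3\gamma(G)$.
   Context: All graphs are finite and simple. $\gamma(G)$ is the domination number: the minimum size of a set $S\subseteq V(G)$ such that every vertex of $V(G)\setminus S$ has a neighbor in $S$. For $f:V(G)\to\{0,1,2\}$ let $V_i=\{v:f(v)=i\}$; $f$ is a total Roman $\{2\}$-dominating function (TR2DF) if every vertex $v$ with $f(v)=0$ has a neighbor $u$ with $f(u)=2$ or two distinct neighbors $x,y$ with $f(x)=f(y)=1$, and the subgraph induced by $V_1\cup V_2$ has no isolated vertices. $\gamma_{tR2}(G)$ is the minimum weight $\sum_v f(v)$ of a TR2DF of $G$. -}

module Defs where

open import Data.Nat using (ℕ; zero; suc; _≤_; _+_)
open import Data.Fin using (Fin)
open import Data.Fin.Subset using (Subset; _∈_; _∉_; ∣_∣)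
open import Data.List using (List; map; allFin)
open import Data.Nat.ListAction using (sum)
open import Data.Product using (Σ; ∃; ∃-syntax; _×_; _,_)
open import Data.Sum using (_⊎_)
open import Relation.Nullary using (¬_; Dec)
open import Relation.Binary.PropositionalEquality using (_≡_; _≢_)

record Graph (n : ℕ) : Set₁ where
  field
    Adj     : Fin n → Fin n → Set
    adj?    : (u v : Fin n) → Dec (Adj u v)
    sym     : ∀ {u v} → Adj u v → Adj v u
    irrefl  : ∀ {u} → ¬ Adj u u
open Graph public

data Walk {n : ℕ} (G : Graph n) : Fin n → Fin n → Set where
  here : ∀ {u} → Walk G u u
  step : ∀ {u v w} → Adj G u v → Walk G v w → Walk G u w

Connected : ∀ {n} → Graph n → Set
Connected G = ∀ u v → Walk G u v

Nontrivial : ∀ {n} → Graph n → Set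
Nontrivial {n} G = 2 ≤ n

IsDominating : ∀ {n} → Graph n → Subset n → Set
IsDominating {n} G S = ∀ (v : Fin n) → v ∉ S → ∃[ u ] (u ∈ S × Adj G v u)

IsDominationNumber : ∀ {n} → Graph n → ℕ → Set
IsDominationNumber {n} G k =
  (∃[ S ] (IsDominating G S × ∣ S ∣ ≡ k)) ×
  (∀ (S : Subset n) → IsDominating G S → k ≤ ∣ S ∣)

weight : ∀ {n} → (Fin n → ℕ) → ℕ
weight {n} f = sum (map f (allFin n))

IsTR2DF : ∀ {n} → Graph n → (Fin n → ℕ) → Set
IsTR2DF {n} G f =
  (∀ v → f v ≤ 2) ×
  (∀ v → f v ≡ 0 →
     (∃[ u ] (Adj G v u × f u ≡ 2)) ⊎
     (∃[ x ] ∃[ y ] (x ≢ y × Adj G v x × Adj G v y × f x ≡ 1 × f y ≡ 1))) ×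
  -- the subgraph induced by V₁ ∪ V₂ has no isolated vertices
  (∀ v → f v ≢ 0 → ∃[ u ] (Adj G v u × f u ≢ 0))

IsTR2Number : ∀ {n} → Graph n → ℕ → Set
IsTR2Number {n} G k =
  (∃[ f ] (IsTR2DF G f × weight f ≡ k)) ×
  (∀ (f : Fin n → ℕ) → IsTR2DF G f → k ≤ weight f)

{-# OPTIONS --safe #-}
-- Let S be a minimum dominating set and choose for every vertex v a neighbour
-- ν(v), which exists since G is connected with at least two vertices. Label the
-- vertices of S with 2, the other vertices of ν(S) with 1 and the rest with 0.
-- A 0-vertex lies outside S, so it has a neighbour labelled 2; a vertex v ∈ S
-- has the positive neighbour ν(v), and ν(v) has the positive neighbour v. The
-- 1-labels are bounded by the pushforward along ν of the indicator of S, whose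
-- total mass is |S|, so the weight is at most 2|S| + |S|.

module Submission where

open import Defs hiding (sym)
open import Data.Bool using (Bool; true; false; if_then_else_)
open import Data.Empty using (⊥-elim)
open import Data.Fin using (Fin; zero; suc)
open import Data.Fin.Properties using (_≟_)
open import Data.Fin.Subset using (Subset; ∣_∣)
open import Data.List using (tabulate)
open import Data.List.Properties using (map-tabulate)
open import Data.Nat using (ℕ; zero; suc; _+_; _*_; _≤_; z≤n; s≤s)
open import Data.Nat.ListAction using () renaming (sum to sumᴸ)
open import Data.Nat.Properties
  using (+-*-semiring; 0≢1+n; +-identityʳ; +-comm; +-mono-≤; ≤-refl; ≤-trans; m≤m+n; m≤n+m; module ≤-Reasoning)
open import Algebra.Properties.Semiring.Sum +-*-semiring
  using (sum; sum-syntax; sum-cong-≗; sum-replicate-zero; ∑-comm; ∑-distrib-+; *-distribˡ-sum)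
open import Data.Product using (∃-syntax; _×_; _,_; proj₁; proj₂)
open import Function using (_∘_)
open import Data.Sum using (_⊎_; inj₁; inj₂)
open import Data.Vec using ([]; _∷_; lookup)
open import Data.Vec.Functional using (Vector)
open import Data.Vec.Properties using ([]=⇒lookup)
open import Relation.Nullary using (does; yes; no)
open import Relation.Nullary.Decidable using (dec-true)
open import Relation.Binary.PropositionalEquality
  using (_≡_; _≢_; refl; sym; trans; cong; cong₂; subst)

sumᴸ-tabulate : ∀ {n} (f : Vector ℕ n) → sumᴸ (tabulate f) ≡ sum f
sumᴸ-tabulate {zero}  f = refl
sumᴸ-tabulate {suc n} f = cong (f zero +_) (sumᴸ-tabulate (λ i → f (suc i)))

weight≡sum : ∀ {n} (f : Vector ℕ n) → weight f ≡ sum f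
weight≡sum f = trans (cong sumᴸ (map-tabulate (λ i → i) f)) (sumᴸ-tabulate f)

sum-mono-≤ : ∀ {n} {f g : Vector ℕ n} → (∀ i → f i ≤ g i) → sum f ≤ sum g
sum-mono-≤ {zero}  f≤g = z≤n
sum-mono-≤ {suc n} f≤g = +-mono-≤ (f≤g zero) (sum-mono-≤ (λ i → f≤g (suc i)))

≤-sum : ∀ {n} (f : Vector ℕ n) i → f i ≤ sum f
≤-sum f zero    = m≤m+n (f zero) _
≤-sum f (suc i) = ≤-trans (≤-sum (λ j → f (suc j)) i) (m≤n+m _ (f zero))

sum≢0⇒∃≢0 : ∀ {n} (f : Vector ℕ n) → sum f ≢ 0 → ∃[ i ] f i ≢ 0
sum≢0⇒∃≢0 {zero}  f sum≢0 = ⊥-elim (sum≢0 refl)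
sum≢0⇒∃≢0 {suc n} f sum≢0 with f zero in f₀≡1+k
... | suc _ = zero , λ f₀≡0 → 0≢1+n (trans (sym f₀≡0) f₀≡1+k)
... | zero  with sum≢0⇒∃≢0 (λ i → f (suc i)) sum≢0
...   | i , fᵢ≢0 = suc i , fᵢ≢0

∑-pointMass : ∀ {n} (i : Fin n) (x : ℕ) → ∑[ w < n ] (if does (i ≟ w) then x else 0) ≡ x
∑-pointMass {suc n} zero    x = trans (cong (x +_) (sum-replicate-zero n)) (+-identityʳ x)
∑-pointMass {suc n} (suc i) x = ∑-pointMass i x

pushforward : ∀ {m n} → (Fin m → Fin n) → Vector ℕ m → Vector ℕ n
pushforward {m} φ a w = ∑[ v < m ] (if does (φ v ≟ w) then a v else 0)

sum-pushforward : ∀ {m n} (φ : Fin m → Fin n) (a : Vector ℕ m) → sum (pushforward φ a) ≡ sum a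
sum-pushforward φ a =
  trans (∑-comm (λ w v → if does (φ v ≟ w) then a v else 0))
        (sum-cong-≗ (λ v → ∑-pointMass (φ v) (a v)))

≤-pushforward : ∀ {m n} (φ : Fin m → Fin n) (a : Vector ℕ m) v → a v ≤ pushforward φ a (φ v)
≤-pushforward φ a v =
  subst (_≤ pushforward φ a (φ v)) (cong (if_then a v else 0) (dec-true (φ v ≟ φ v) refl))
        (≤-sum (λ u → if does (φ u ≟ φ v) then a u else 0) v)

pushforward≢0⇒preimage : ∀ {m n} (φ : Fin m → Fin n) (a : Vector ℕ m) w →
                         pushforward φ a w ≢ 0 → ∃[ v ] (a v ≢ 0 × φ v ≡ w)
pushforward≢0⇒preimage φ a w push≢0
  with sum≢0⇒∃≢0 (λ v → if does (φ v ≟ w) then a v else 0) push≢0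
... | v , term≢0 with φ v ≟ w
...   | yes φv≡w = v , term≢0 , φv≡w
...   | no _     = ⊥-elim (term≢0 refl)

indicator : ∀ {n} → Subset n → Vector ℕ n
indicator S w = if lookup S w then 1 else 0

sum-indicator : ∀ {n} (S : Subset n) → sum (indicator S) ≡ ∣ S ∣
sum-indicator []          = refl
sum-indicator (true ∷ S)  = cong suc (sum-indicator S)
sum-indicator (false ∷ S) = sum-indicator S

indicator≢0⇒∈ : ∀ {n} (S : Subset n) w → indicator S w ≢ 0 → lookup S w ≡ true
indicator≢0⇒∈ S w ind≢0 with lookup S w
... | true  = refl
... | false = ⊥-elim (ind≢0 refl)

walk⇒neighbour : ∀ {n} {G : Graph n} {u v} → Walk G u v → u ≢ v → ∃[ w ] Adj G u w
walk⇒neighbour here         u≢u = ⊥-elim (u≢u refl)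
walk⇒neighbour (step u~w _) _   = _ , u~w

connected⇒neighbour : ∀ {n} (G : Graph n) → Nontrivial G → Connected G → ∀ v → ∃[ u ] Adj G v u
connected⇒neighbour {suc (suc _)} G (s≤s (s≤s z≤n)) connected v with v ≟ zero
... | yes refl = walk⇒neighbour (connected v (suc zero)) (λ ())
... | no v≢0   = walk⇒neighbour (connected v zero) v≢0

value : Bool → ℕ → ℕ
value true  _       = 2
value false zero    = 0
value false (suc _) = 1

value≤2 : ∀ b k → value b k ≤ 2
value≤2 true  _       = ≤-refl
value≤2 false zero    = z≤n
value≤2 false (suc _) = s≤s z≤n

value≤ : ∀ b k → value b k ≤ 2 * (if b then 1 else 0) + k
value≤ true  k       = m≤m+n 2 k
value≤ false zero    = z≤n
value≤ false (suc _) = s≤s z≤n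

value≢0 : ∀ b k → value b k ≢ 0 → b ≡ true ⊎ k ≢ 0
value≢0 true  _       _     = inj₁ refl
value≢0 false zero    val≢0 = ⊥-elim (val≢0 refl)
value≢0 false (suc _) _     = inj₂ (λ ())

value-pos : ∀ b {k} → 1 ≤ k → value b k ≢ 0
value-pos true  _         = λ ()
value-pos false (s≤s z≤n) = λ ()

module TotalRoman {n} (G : Graph n) (ν : Fin n → Fin n) (ν-adj : ∀ v → Adj G v (ν v))
                  (S : Subset n) where

  load : Vector ℕ n
  load = pushforward ν (indicator S)

  f : Vector ℕ n
  f w = value (lookup S w) (load w)

  f≡2 : ∀ w → lookup S w ≡ true → f w ≡ 2
  f≡2 w w∈S = cong (λ b → value b (load w)) w∈S

  f≢0 : ∀ w → lookup S w ≡ true → f w ≢ 0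
  f≢0 w w∈S fw≡0 = 0≢1+n (trans (sym fw≡0) (f≡2 w w∈S))

  load-ν : ∀ v → lookup S v ≡ true → 1 ≤ load (ν v)
  load-ν v v∈S =
    subst (λ b → (if b then 1 else 0) ≤ load (ν v)) v∈S (≤-pushforward ν (indicator S) v)

  weight-f : weight f ≤ 3 * ∣ S ∣
  weight-f = begin
    weight f                                      ≡⟨ weight≡sum f ⟩
    sum f                                         ≤⟨ sum-mono-≤ (λ w → value≤ (lookup S w) (load w)) ⟩
    ∑[ w < n ] (2 * indicator S w + load w)       ≡⟨ ∑-distrib-+ (λ w → 2 * indicator S w) load ⟩
    ∑[ w < n ] (2 * indicator S w) + sum load     ≡⟨ cong₂ _+_ (sym (*-distribˡ-sum 2 (indicator S)))
                                                               (sum-pushforward ν (indicator S)) ⟩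
    2 * sum (indicator S) + sum (indicator S)     ≡⟨ cong (λ s → 2 * s + s) (sum-indicator S) ⟩
    2 * ∣ S ∣ + ∣ S ∣                             ≡⟨ +-comm (2 * ∣ S ∣) ∣ S ∣ ⟩
    3 * ∣ S ∣                                     ∎
    where open ≤-Reasoning

  f-dominates : IsDominating G S → ∀ v → f v ≡ 0 → ∃[ u ] (Adj G v u × f u ≡ 2)
  f-dominates dom v fv≡0 with dom v (λ v∈S → f≢0 v ([]=⇒lookup v∈S) fv≡0)
  ... | u , u∈S , v~u = u , v~u , f≡2 u ([]=⇒lookup u∈S)

  f-noIsolated : ∀ v → f v ≢ 0 → ∃[ u ] (Adj G v u × f u ≢ 0)
  f-noIsolated v fv≢0 with value≢0 (lookup S v) (load v) fv≢0
  ... | inj₁ v∈S   = ν v , ν-adj v , value-pos (lookup S (ν v)) (load-ν v v∈S)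
  ... | inj₂ load≢0 with pushforward≢0⇒preimage ν (indicator S) v load≢0
  ...   | u , u∈S , νu≡v =
          u , Graph.sym G (subst (Adj G u) νu≡v (ν-adj u)) , f≢0 u (indicator≢0⇒∈ S u u∈S)

  f-TR2DF : IsDominating G S → IsTR2DF G f
  f-TR2DF dom = (λ w → value≤2 (lookup S w) (load w)) , (λ v → inj₁ ∘ f-dominates dom v) , f-noIsolated

dominating⇒TR2DF : ∀ {n} (G : Graph n) → (∀ v → ∃[ u ] Adj G v u) →
                   ∀ S → IsDominating G S → ∃[ f ] (IsTR2DF G f × weight f ≤ 3 * ∣ S ∣)
dominating⇒TR2DF G neighbour S dom = f , f-TR2DF dom , weight-f
  where open TotalRoman G (proj₁ ∘ neighbour) (proj₂ ∘ neighbour) S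

mainTheorem5 : ∀ {n : ℕ} (G : Graph n) → Nontrivial G → Connected G →
                 ∀ (d t : ℕ) → IsDominationNumber G d → IsTR2Number G t →
                 t ≤ 3 * d
mainTheorem5 G nontrivial connected d t ((S , S-dom , ∣S∣≡d) , _) (_ , t-minimal)
  with dominating⇒TR2DF G (connected⇒neighbour G nontrivial connected) S S-dom
... | f , f-TR2DF , weight≤3∣S∣ = begin
  t         ≤⟨ t-minimal f f-TR2DF ⟩
  weight f  ≤⟨ weight≤3∣S∣ ⟩
  3 * ∣ S ∣ ≡⟨ cong (3 *_) ∣S∣≡d ⟩
  3 * d     ∎
  where open ≤-Reasoning
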